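{- Let $\mathcal D$ be the stream comonad on $\mathbf{Set}$, $R\in\mathbf{Set}$ and $S=(S_0,\mathbb N\Rightarrow R)\in\mathbf{Pred}$ a single lifting parameter for $\mathcal D$, and let $\dot D$ be the density lifting of $\mathcal D$ along $p:\mathbf{Pred}\to\mathbf{Set}$ with this parameter. Then for any $X\in\mathbf{Pred}$ and $x\in\mathbb N\Rightarrow X_1$: $$x\in(\dot DX)_0\iff\exists v\in S_0.\ \big(\forall i\in\mathbb N.\ v/i\in S_0\implies x(i)\in X_0\big)\wedge\big(\forall m,n\in\mathbb N.\ v/n=v/m\implies x(n)=x(m)\big).$$
   Context: $\mathbf{Pred}$: objects are pairs $X=(X_0,X_1)$ of sets with $X_0\subseteq X_1$; morphisms $(X_0,X_1)\to(Y_0,Y_1)$ are functions $f:X_1\to Y_1$ with $f(X_0)\subseteq Y_0$; $p(X_0,X_1)=X_1$. The stream comonad $\mathcal D$ on $\mathbf{Set}$ has $DI=\mathbb N\Rightarrow I$ (infinite sequences), counit $\epsilon_I(l)=l(0)$, comultiplication $\delta_I(l)(m)=l/m$, where $l/i=\lambda j.\,l(i+j)$; the co-Kleisli extension of $f:DI\to J$ is $f^\flat=Df\circ\delta_I$, i.e. $f^\flat(s)=\lambda m.f(s/m)$. For a single lifting parameter ($R\in\mathbf{Set}$, $S\in\mathbf{Pred}$ with $S_1=DR$), the density lifting (dual of the codensity lifting, along the cofibration $p$) is the comonad $\dot D$ on $\mathbf{Pred}$ lifting $\mathcal D$ with object part $\dot DX=(\{(pf)^\flat(s)\mid f\in\mathbf{Pred}(S,X),s\in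 S_0\},DX_1)=(\{\lambda m.f(s/m)\mid f\in\mathbf{Pred}(S,X),s\in S_0\},\mathbb N\Rightarrow X_1)$. -}

module Defs where

open import Level using (0ℓ)
open import Data.Nat using (ℕ; _+_)
open import Data.Product using (Σ; _×_)
open import Relation.Binary.PropositionalEquality using (_≡_)
open import Axiom.Extensionality.Propositional using (Extensionality)
open import Axiom.ExcludedMiddle using (ExcludedMiddle)

-- Ambient classical, extensional set theory (the paper works in Set).
ClassicalSet : Set₁
ClassicalSet = Extensionality 0ℓ 0ℓ × ExcludedMiddle 0ℓ

D : Set → Set
D I = ℕ → I

_/ₛ_ : {I : Set} → D I → ℕ → D I
(l /ₛ i) = λ j → l (i + j)

εD : {I : Set} → D I → I
εD l = l 0

δD : {I : Set} → D I → D (D I)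
δD l m = l /ₛ m

Dmap : {I J : Set} → (I → J) → D I → D J
Dmap f l m = f (l m)

_♭ : {I J : Set} → (D I → J) → D I → D J
(f ♭) s = Dmap f (δD s)

-- The category Pred: X₀ ⊆ X₁ represented as a predicate on X₁
record Pred : Set₁ where
  constructor pred
  field
    U   : Set          -- X₁
    In  : U → Set      -- membership in X₀
open Pred public

record Hom (X Y : Pred) : Set where
  constructor hom
  field
    fun : U X → U Y
    pres : ∀ x → In X x → In Y (fun x)
open Hom public

p : Pred → Set
p = U

Param : (R : Set) → (S₀ : D R → Set) → Pred
Param R S₀ = pred (D R) S₀

Ḋ : (R : Set) → (S₀ : D R → Set) → Pred → Pred
Ḋ R S₀ X = pred (D (U X))
  (λ x → Σ (Hom (Param R S₀) X) λ f → Σ (D R) λ s → S₀ s × (x ≡ (fun f ♭) s))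

-- A morphism f : S → X yields the stream x = λ i. f (s / i), so x i lies in X₀ whenever
-- s / i lies in S₀, and x takes equal values on equal suffixes of s. Conversely, given v
-- with these two properties, define f w := x i if w = v / i for some i, and x 0 otherwise:
-- the second property makes this independent of the choice of i, the first makes f a
-- morphism of Pred, and (f ♭) v = x pointwise. Deciding whether w is a suffix of v needs
-- excluded middle, and passing from pointwise to stream equality needs extensionality.
module Submission where

open import Level using (0ℓ)
open import Defs
open import Data.Nat using (ℕ)
open import Data.Product using (Σ; _×_; _,_)
open import Relation.Binary.PropositionalEquality using (_≡_; refl; sym; trans; cong; cong-app; subst)
open import Relation.Nullary using (Dec; yes; no)
open import Axiom.ExcludedMiddle using (ExcludedMiddle)
open import Function.Bundles using (_⇔_; mk⇔)

module _ {I A : Set} where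

  IsSuffixOf : D I → D I → Set
  IsSuffixOf w v = Σ ℕ (λ i → w ≡ v /ₛ i)

  RespectsSuffixes : D I → D A → Set
  RespectsSuffixes v x = ∀ (m n : ℕ) → v /ₛ n ≡ v /ₛ m → x n ≡ x m

  ♭-respectsSuffixes : (f : D I → A) (s : D I) → RespectsSuffixes s ((f ♭) s)
  ♭-respectsSuffixes f s m n e = cong f e

  readOff : (v : D I) (x : D A) (w : D I) → Dec (IsSuffixOf w v) → A
  readOff v x w (yes (i , _)) = x i
  readOff v x w (no _)        = x 0

  readOff-suffix : (v : D I) (x : D A) → RespectsSuffixes v x →
                   ∀ k (d : Dec (IsSuffixOf (v /ₛ k) v)) → readOff v x (v /ₛ k) d ≡ x k
  readOff-suffix v x resp k (yes (i , e)) = sym (resp i k e)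
  readOff-suffix v x resp k (no ¬suffix) with () ← ¬suffix (k , refl)

  readOff-pres : (P : D I → Set) (Q : A → Set) (v : D I) (x : D A) →
                 P v → (∀ i → P (v /ₛ i) → Q (x i)) →
                 ∀ w → P w → (d : Dec (IsSuffixOf w v)) → Q (readOff v x w d)
  readOff-pres P Q v x Pv h w Pw (yes (i , e)) = h i (subst P e Pw)
  readOff-pres P Q v x Pv h w Pw (no _)        = h 0 Pv

module _ (R : Set) (S₀ : D R → Set) (X : Pred) (x : D (U X)) where

  DensityWitness : D R → Set
  DensityWitness v = S₀ v × ((∀ (i : ℕ) → S₀ (v /ₛ i) → In X (x i)) × RespectsSuffixes v x)

  Ḋ-witness : In (Ḋ R S₀ X) x → Σ (D R) DensityWitness
  Ḋ-witness (f , s , s∈S₀ , x≡f♭s) = s , s∈S₀ , inX , resp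
    where
    inX : ∀ i → S₀ (s /ₛ i) → In X (x i)
    inX i si = subst (In X) (sym (cong-app x≡f♭s i)) (pres f (s /ₛ i) si)

    resp : RespectsSuffixes s x
    resp m n e = trans (cong-app x≡f♭s n)
                   (trans (♭-respectsSuffixes (fun f) s m n e) (sym (cong-app x≡f♭s m)))

  readOffHom : ExcludedMiddle 0ℓ → (v : D R) → DensityWitness v → Hom (Param R S₀) X
  readOffHom lem v (v∈S₀ , inX , _) =
    hom (λ w → readOff v x w lem) (λ w w∈S₀ → readOff-pres S₀ (In X) v x v∈S₀ inX w w∈S₀ lem)

  witness-Ḋ : ClassicalSet → Σ (D R) DensityWitness → In (Ḋ R S₀ X) x
  witness-Ḋ (ext , lem) (v , wit@(v∈S₀ , _ , resp)) =
    readOffHom lem v wit , v , v∈S₀ , ext (λ k → sym (readOff-suffix v x resp k lem))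

theorem5p2 : ClassicalSet → (R : Set) (S₀ : D R → Set) (X : Pred) (x : D (U X)) →
    In (Ḋ R S₀ X) x ⇔
    Σ (D R) (λ v → S₀ v ×
      ((∀ (i : ℕ) → S₀ (v /ₛ i) → In X (x i)) ×
       (∀ (m n : ℕ) → v /ₛ n ≡ v /ₛ m → x n ≡ x m)))
theorem5p2 classical R S₀ X x = mk⇔ (Ḋ-witness R S₀ X x) (witness-Ḋ R S₀ X x classical)
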